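{- Let $G$ be a finite simple bipartite graph without isolated vertices whose independence complex $\mathrm{Ind}(G)$ is pure. Then every pure order of $G$ has a cross if and only if some pure order of $G$ has a cross.
   Context: $\mathrm{Ind}(G)$ is the complex of independent sets of $G$; pure means all maximal faces have the same size. A pure order of $G$ is a partition of the vertex set of $G$ into two sets $V_1=\{x_1,\ldots,x_n\}$ and $V_2=\{y_1,\ldots,y_n\}$, each independent, such that (i) $x_iy_i$ is an edge for all $1\le i\le n$, and (ii) whenever $x_iy_j$ and $x_jy_k$ are edges with $i,j,k$ distinct, $x_iy_k$ is an edge. A pure order has a cross if for some $i\ne j$ both $x_iy_j$ and $x_jy_i$ are edges; otherwise it is cross-free. (For bipartite graphs without isolated vertices, $\mathrm{Ind}(G)$ is pure iff a pure order exists.) -}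

module Defs where

open import Data.Nat using (ℕ)
open import Data.Bool using (Bool; true; false)
open import Data.Fin using (Fin)
open import Data.Fin.Subset using (Subset; _∈_; _⊆_; ∣_∣)
open import Data.Product using (Σ; ∃; _×_)
open import Data.Sum using (_⊎_)
open import Relation.Binary.PropositionalEquality using (_≡_; _≢_)
open import Function.Definitions using (Injective)

record Graph : Set where
  field
    vtx   : ℕ
    adj   : Fin vtx → Fin vtx → Bool
    sym   : ∀ u v → adj u v ≡ adj v u
    irrefl : ∀ v → adj v v ≡ false

module _ (G : Graph) where
  open Graph G

  Edge : Fin vtx → Fin vtx → Set
  Edge u v = adj u v ≡ true

  Bipartite : Set
  Bipartite = Σ (Fin vtx → Bool) λ c → ∀ u v → Edge u v → c u ≢ c v

  NoIsolated : Set
  NoIsolated = ∀ v → ∃ λ w → Edge v w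

  -- independent sets of G = faces of Ind(G)
  Independent : Subset vtx → Set
  Independent S = ∀ u v → u ∈ S → v ∈ S → adj u v ≡ false

  MaximalIndependent : Subset vtx → Set
  MaximalIndependent S =
    Independent S × (∀ T → Independent T → S ⊆ T → T ⊆ S)

  PureInd : Set
  PureInd = ∀ S T → MaximalIndependent S → MaximalIndependent T → ∣ S ∣ ≡ ∣ T ∣

  -- A pure order: V₁ = {x 1..x n}, V₂ = {y 1..y n}, a partition of the
  -- vertex set into two independent sets (listed without repetition)
  -- satisfying conditions (i) and (ii).
  record PureOrder : Set where
    field
      n      : ℕ
      x      : Fin n → Fin vtx
      y      : Fin n → Fin vtx
      x-inj  : Injective _≡_ _≡_ x
      y-inj  : Injective _≡_ _≡_ y
      disj   : ∀ i j → x i ≢ y j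
      cover  : ∀ v → (∃ λ i → x i ≡ v) ⊎ (∃ λ i → y i ≡ v)
      x-ind  : ∀ i j → adj (x i) (x j) ≡ false
      y-ind  : ∀ i j → adj (y i) (y j) ≡ false
      cond-i  : ∀ i → Edge (x i) (y i)
      cond-ii : ∀ i j k → i ≢ j → j ≢ k → i ≢ k →
                Edge (x i) (y j) → Edge (x j) (y k) → Edge (x i) (y k)

  HasCross : PureOrder → Set
  HasCross P = ∃ λ i → ∃ λ j → i ≢ j × Edge (x i) (y j) × Edge (x j) (y i)
    where open PureOrder P

-- "⇒" only needs a pure order to exist. This is Villarreal's theorem: the colour classes
-- A and B are maximal independent sets, purity yields Hall's condition for matching A into
-- B, the matching (onto B, as ∣ A ∣ = ∣ B ∣) lists the vertices as pairs x i – y i, and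
-- condition (ii) follows from purity by a counting argument (pure⇒cond-ii).
-- "⇐": a cross a, b in a pure order P gives two different perfect matchings of G (pair
-- x i with y i, or swap the partners of a and b). In a cross-free pure order Q, the edges
-- x i – y j (i ≢ j) form a strict order, and every perfect matching induces an injection
-- of the indices moving each one upward; such a map is the identity, so Q admits only one
-- perfect matching. Hence every pure order has a cross.
module Submission where

open import Defs
open import Data.Product using (∃)
open import Function.Bundles using (_⇔_; mk⇔)

open import Data.Nat using (ℕ; zero; suc; _+_; _≤_; _<_; _≤?_; z≤n; s≤s)
open import Data.Nat.Properties
  using (≤-trans; ≤-reflexive; +-suc; +-comm; +-identityʳ; +-monoʳ-≤; +-cancelʳ-≤; m≤m+n;
         ≰⇒>; <⇒≱; n≮0; n<1+n; m≤n⇒∃[o]m+o≡n; module ≤-Reasoning)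
open import Data.Nat.GeneralisedArithmetic using (fold; fold-+)
open import Data.Bool using (Bool; true; false; not)
import Data.Bool as Bool
open import Data.Bool.Properties using (¬-not; not-involutive)
open import Data.Fin using (Fin; zero; suc; toℕ)
import Data.Fin as Fin
open import Data.Fin.Properties using (any?; all?; suc-injective; pigeonhole)
open import Data.Fin.Subset
open import Data.Fin.Subset.Properties
open import Data.Fin.Subset.Induction using (⊃-wellFounded; ⊂-wellFounded; Acc; acc)
open import Data.Fin.Permutation using (Permutation; _⟨$⟩ʳ_; _⟨$⟩ˡ_; inverseˡ; inverseʳ; id; transpose)
open import Data.Vec using ([]; _∷_; here; there; tabulate)
open import Data.Vec.Properties using (lookup∘tabulate; []=⇒lookup; lookup⇒[]=)
open import Data.Product using (_×_; _,_; proj₁; proj₂; uncurry)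
open import Data.Sum using (_⊎_; inj₁; inj₂)
open import Relation.Binary.PropositionalEquality
open import Relation.Nullary using (Dec; yes; no; does; ¬_; contradiction)
open import Relation.Nullary.Decidable using (_×-dec_; _→-dec_; ¬?; dec-true)
open import Relation.Unary using (Pred; Decidable)

∣p∪q∣+∣p∩q∣≡∣p∣+∣q∣ : ∀ {n} (p q : Subset n) → ∣ p ∪ q ∣ + ∣ p ∩ q ∣ ≡ ∣ p ∣ + ∣ q ∣
∣p∪q∣+∣p∩q∣≡∣p∣+∣q∣ [] [] = refl
∣p∪q∣+∣p∩q∣≡∣p∣+∣q∣ (inside ∷ p) (inside ∷ q) =
  cong suc (trans (+-suc _ _) (trans (cong suc (∣p∪q∣+∣p∩q∣≡∣p∣+∣q∣ p q)) (sym (+-suc _ _))))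
∣p∪q∣+∣p∩q∣≡∣p∣+∣q∣ (inside ∷ p) (outside ∷ q) = cong suc (∣p∪q∣+∣p∩q∣≡∣p∣+∣q∣ p q)
∣p∪q∣+∣p∩q∣≡∣p∣+∣q∣ (outside ∷ p) (inside ∷ q) =
  trans (cong suc (∣p∪q∣+∣p∩q∣≡∣p∣+∣q∣ p q)) (sym (+-suc _ _))
∣p∪q∣+∣p∩q∣≡∣p∣+∣q∣ (outside ∷ p) (outside ∷ q) = ∣p∪q∣+∣p∩q∣≡∣p∣+∣q∣ p q

empty⇒∣p∣≡0 : ∀ {n} {p : Subset n} → Empty p → ∣ p ∣ ≡ 0
empty⇒∣p∣≡0 {n} empty = trans (cong ∣_∣ (Empty-unique empty)) (∣⊥∣≡0 n)

split-by : ∀ {n} {p q r : Subset n} → p ∩ q ⊆ r → p ⊆ r ∪ (p ─ q)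
split-by {q = q} p∩q⊆r {x} x∈p with x ∈? q
... | yes x∈q = x∈p∪q⁺ (inj₁ (p∩q⊆r (x∈p∩q⁺ (x∈p , x∈q))))
... | no  x∉q = x∈p∪q⁺ (inj₂ (x∈p∧x∉q⇒x∈p─q x∈p x∉q))

⊆∪⇒∣∣≤∣∣+∣∣ : ∀ {n} {r : Subset n} (p q : Subset n) → r ⊆ p ∪ q → ∣ r ∣ ≤ ∣ p ∣ + ∣ q ∣
⊆∪⇒∣∣≤∣∣+∣∣ p q r⊆p∪q =
  ≤-trans (p⊆q⇒∣p∣≤∣q∣ r⊆p∪q)
          (≤-trans (m≤m+n _ _) (≤-reflexive (∣p∪q∣+∣p∩q∣≡∣p∣+∣q∣ p q)))

Disjoint : ∀ {n} → Subset n → Subset n → Set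
Disjoint p q = ∀ {x} → x ∈ p → x ∉ q

disjoint⇒∣p∪q∣≡∣p∣+∣q∣ : ∀ {n} (p q : Subset n) → Disjoint p q → ∣ p ∪ q ∣ ≡ ∣ p ∣ + ∣ q ∣
disjoint⇒∣p∪q∣≡∣p∣+∣q∣ p q disj = begin
  ∣ p ∪ q ∣             ≡⟨ sym (+-identityʳ _) ⟩
  ∣ p ∪ q ∣ + 0         ≡⟨ cong (∣ p ∪ q ∣ +_) (sym ∣p∩q∣≡0) ⟩
  ∣ p ∪ q ∣ + ∣ p ∩ q ∣ ≡⟨ ∣p∪q∣+∣p∩q∣≡∣p∣+∣q∣ p q ⟩
  ∣ p ∣ + ∣ q ∣         ∎
  where
  open ≡-Reasoning
  ∣p∩q∣≡0 : ∣ p ∩ q ∣ ≡ 0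
  ∣p∩q∣≡0 = empty⇒∣p∣≡0 λ (x , x∈p∩q) → uncurry disj (x∈p∩q⁻ p q x∈p∩q)

∣p∣>0⇒nonempty : ∀ {n} (p : Subset n) → 0 < ∣ p ∣ → Nonempty p
∣p∣>0⇒nonempty p 0<∣p∣ with nonempty? p
... | yes ne   = ne
... | no empty = contradiction (subst (0 <_) (empty⇒∣p∣≡0 empty) 0<∣p∣) n≮0

x∈p─q⇒x∉q : ∀ {n} {x : Fin n} (p q : Subset n) → x ∈ p ─ q → x ∉ q
x∈p─q⇒x∉q (_ ∷ p) (outside ∷ q) here        = λ ()
x∈p─q⇒x∉q (_ ∷ p) (_ ∷ q)       (there x∈) = λ x∈q → x∈p─q⇒x∉q p q x∈ (drop-there x∈q)

MapsInto : ∀ {m n} → Subset m → Subset n → (Fin m → Fin n) → Set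
MapsInto p q f = ∀ {x} → x ∈ p → f x ∈ q

InjectiveOn : ∀ {m n} → Subset m → (Fin m → Fin n) → Set
InjectiveOn p f = ∀ {x y} → x ∈ p → y ∈ p → f x ≡ f y → x ≡ y

injection⇒≤ : ∀ {m n} (p : Subset m) {q : Subset n} {f : Fin m → Fin n} →
              MapsInto p q f → InjectiveOn p f → ∣ p ∣ ≤ ∣ q ∣
injection⇒≤ []            into inj = z≤n
injection⇒≤ (outside ∷ p) into inj =
  injection⇒≤ p (λ x∈ → into (there x∈)) (λ x∈ y∈ e → suc-injective (inj (there x∈) (there y∈) e))
injection⇒≤ (inside ∷ p) {q} {f} into inj =
  ≤-trans (s≤s (injection⇒≤ p into-q-minus-f0 (λ x∈ y∈ e → suc-injective (inj (there x∈) (there y∈) e))))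
          (x∈p⇒∣p-x∣<∣p∣ (into here))
  where
  into-q-minus-f0 : MapsInto p (q - f zero) (λ x → f (suc x))
  into-q-minus-f0 x∈ = x∈p∧x≢y⇒x∈p-y (into (there x∈)) (λ e → suc≢zero (inj (there x∈) here e))
    where
    suc≢zero : ∀ {k} {x : Fin k} → suc x ≢ zero
    suc≢zero ()

injection⇒onto : ∀ {m n} (p : Subset m) {q : Subset n} {f : Fin m → Fin n} →
                 ∣ q ∣ ≤ ∣ p ∣ → MapsInto p q f → InjectiveOn p f →
                 ∀ {y} → y ∈ q → ∃ λ x → x ∈ p × f x ≡ y
injection⇒onto p {q} {f} ∣q∣≤∣p∣ into inj {y} y∈q with any? (λ x → (x ∈? p) ×-dec (f x Fin.≟ y))
... | yes hit = hit
... | no miss = contradiction ∣q∣≤∣p∣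
                  (<⇒≱ (≤-trans (s≤s (injection⇒≤ p into-q-minus-y inj)) (x∈p⇒∣p-x∣<∣p∣ y∈q)))
  where
  into-q-minus-y : MapsInto p (q - y) f
  into-q-minus-y x∈ = x∈p∧x≢y⇒x∈p-y (into x∈) (λ e → miss (_ , x∈ , e))

enum : ∀ {n} (p : Subset n) → Fin ∣ p ∣ → Fin n
enum (inside ∷ p)  zero    = zero
enum (inside ∷ p)  (suc i) = suc (enum p i)
enum (outside ∷ p) i       = suc (enum p i)

enum-∈ : ∀ {n} (p : Subset n) i → enum p i ∈ p
enum-∈ (inside ∷ p)  zero    = here
enum-∈ (inside ∷ p)  (suc i) = there (enum-∈ p i)
enum-∈ (outside ∷ p) i       = there (enum-∈ p i)

enum-injective : ∀ {n} (p : Subset n) {i j} → enum p i ≡ enum p j → i ≡ j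
enum-injective (inside ∷ p)  {zero}  {zero}  e = refl
enum-injective (inside ∷ p)  {suc i} {suc j} e = cong suc (enum-injective p (suc-injective e))
enum-injective (outside ∷ p)                 e = enum-injective p (suc-injective e)

enum-onto : ∀ {n} (p : Subset n) {x} → x ∈ p → ∃ λ i → enum p i ≡ x
enum-onto (inside ∷ p)  here        = zero , refl
enum-onto (inside ∷ p)  (there x∈p) = let i , e = enum-onto p x∈p in suc i , cong suc e
enum-onto (outside ∷ p) (there x∈p) = let i , e = enum-onto p x∈p in i , cong suc e

⟦_⟧ : ∀ {n ℓ} {P : Pred (Fin n) ℓ} → Decidable P → Subset n
⟦ P? ⟧ = tabulate (λ x → does (P? x))

∈⟦⟧⁺ : ∀ {n ℓ} {P : Pred (Fin n) ℓ} (P? : Decidable P) {x} → P x → x ∈ ⟦ P? ⟧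
∈⟦⟧⁺ P? {x} px = lookup⇒[]= x _ (trans (lookup∘tabulate _ x) (dec-true (P? x) px))

∈⟦⟧⁻ : ∀ {n ℓ} {P : Pred (Fin n) ℓ} (P? : Decidable P) {x} → x ∈ ⟦ P? ⟧ → P x
∈⟦⟧⁻ P? {x} x∈ with P? x | trans (sym (lookup∘tabulate (λ y → does (P? y)) x)) ([]=⇒lookup x∈)
... | yes px | _  = px
... | no _   | ()

-- In a decidable family of subsets of a finite set, every member lies below a
-- ⊆-maximal member (recursion along strict supersets, which is well founded).
extend-to-maximal : ∀ {n ℓ} {P : Pred (Subset n) ℓ} → Decidable P → ∀ {S} → P S →
                    ∃ λ M → S ⊆ M × P M × (∀ T → P T → M ⊆ T → T ⊆ M)
extend-to-maximal {P = P} P? {S} PS = go S (⊃-wellFounded S) PS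
  where
  go : ∀ S → Acc _⊃_ S → P S → ∃ λ M → S ⊆ M × P M × (∀ T → P T → M ⊆ T → T ⊆ M)
  go S (acc larger) PS with anySubset? (λ T → P? T ×-dec (S ⊂? T))
  ... | yes (T , PT , S⊂T) =
    let M , T⊆M , PM , maximal = go T (larger S⊂T) PT in M , (λ x∈S → T⊆M (proj₁ S⊂T x∈S)) , PM , maximal
  ... | no no-larger = S , (λ x∈S → x∈S) , PS , maximal
    where
    maximal : ∀ T → P T → S ⊆ T → T ⊆ S
    maximal T PT S⊆T {x} x∈T with x ∈? S
    ... | yes x∈S = x∈S
    ... | no x∉S  = contradiction (T , PT , (λ {y} → S⊆T {y}) , x , x∈T , x∉S) no-larger

module Hall {n} {E : Fin n → Fin n → Set} (E? : ∀ a b → Dec (E a b)) where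

  has-neighbour-in? : ∀ S → Decidable (λ b → ∃ λ a → a ∈ S × E a b)
  has-neighbour-in? S b = any? (λ a → (a ∈? S) ×-dec E? a b)

  nbh : Subset n → Subset n
  nbh S = ⟦ has-neighbour-in? S ⟧

  ∈nbh⁺ : ∀ {S a b} → a ∈ S → E a b → b ∈ nbh S
  ∈nbh⁺ {S} a∈S e = ∈⟦⟧⁺ (has-neighbour-in? S) (_ , a∈S , e)

  ∈nbh⁻ : ∀ {S b} → b ∈ nbh S → ∃ λ a → a ∈ S × E a b
  ∈nbh⁻ {S} = ∈⟦⟧⁻ (has-neighbour-in? S)

  nbh-mono : ∀ {S T} → S ⊆ T → nbh S ⊆ nbh T
  nbh-mono S⊆T b∈ = let a , a∈S , e = ∈nbh⁻ b∈ in ∈nbh⁺ (S⊆T a∈S) e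

  HallCondition : Subset n → Subset n → Set
  HallCondition A B = ∀ S → S ⊆ A → ∣ S ∣ ≤ ∣ B ∩ nbh S ∣

  record Matching (A B : Subset n) : Set where
    field
      partner           : Fin n → Fin n
      partner-∈         : MapsInto A B partner
      partner-edge      : ∀ {a} → a ∈ A → E a (partner a)
      partner-injective : InjectiveOn A partner

  open Matching

  empty-matching : ∀ {A B} → Empty A → Matching A B
  empty-matching empty = record
    { partner = λ a → a ; partner-∈ = λ a∈A → contradiction (_ , a∈A) empty
    ; partner-edge = λ a∈A → contradiction (_ , a∈A) empty ; partner-injective = λ _ _ e → e }

  single-matching : ∀ {a b} → E a b → Matching ⁅ a ⁆ ⁅ b ⁆
  single-matching {a} {b} e = record
    { partner = λ _ → b ; partner-∈ = λ _ → x∈⁅x⁆ b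
    ; partner-edge = λ a′∈ → subst (λ a′ → E a′ b) (sym (x∈⁅y⁆⇒x≡y a a′∈)) e
    ; partner-injective = λ a₁∈ a₂∈ _ → trans (x∈⁅y⁆⇒x≡y a a₁∈) (sym (x∈⁅y⁆⇒x≡y a a₂∈)) }

  restrict : ∀ {A A′ B B′} → A′ ⊆ A → B ⊆ B′ → Matching A B → Matching A′ B′
  restrict A′⊆A B⊆B′ M = record
    { partner = partner M ; partner-∈ = λ a∈ → B⊆B′ (partner-∈ M (A′⊆A a∈))
    ; partner-edge = λ a∈ → partner-edge M (A′⊆A a∈)
    ; partner-injective = λ a₁∈ a₂∈ → partner-injective M (A′⊆A a₁∈) (A′⊆A a₂∈) }

  join : ∀ {A₁ A₂ B₁ B₂} → Matching A₁ B₁ → Matching A₂ B₂ → Disjoint B₁ B₂ →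
         Matching (A₁ ∪ A₂) (B₁ ∪ B₂)
  join {A₁} {A₂} {B₁} {B₂} M₁ M₂ disj = record
    { partner = h ; partner-∈ = h-∈ ; partner-edge = h-edge ; partner-injective = h-inj }
    where
    h : Fin n → Fin n
    h a with a ∈? A₁
    ... | yes _ = partner M₁ a
    ... | no  _ = partner M₂ a

    in-A₂ : ∀ {a} → a ∈ A₁ ∪ A₂ → a ∉ A₁ → a ∈ A₂
    in-A₂ {a} a∈ a∉A₁ with x∈p∪q⁻ A₁ A₂ a∈
    ... | inj₁ a∈A₁ = contradiction a∈A₁ a∉A₁
    ... | inj₂ a∈A₂ = a∈A₂

    h-∈ : MapsInto (A₁ ∪ A₂) (B₁ ∪ B₂) h
    h-∈ {a} a∈ with a ∈? A₁
    ... | yes a∈A₁ = x∈p∪q⁺ (inj₁ (partner-∈ M₁ a∈A₁))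
    ... | no  a∉A₁ = x∈p∪q⁺ (inj₂ (partner-∈ M₂ (in-A₂ a∈ a∉A₁)))

    h-edge : ∀ {a} → a ∈ A₁ ∪ A₂ → E a (h a)
    h-edge {a} a∈ with a ∈? A₁
    ... | yes a∈A₁ = partner-edge M₁ a∈A₁
    ... | no  a∉A₁ = partner-edge M₂ (in-A₂ a∈ a∉A₁)

    h-inj : InjectiveOn (A₁ ∪ A₂) h
    h-inj {a} {a′} a∈ a′∈ e with a ∈? A₁ | a′ ∈? A₁
    ... | yes a∈A₁ | yes a′∈A₁ = partner-injective M₁ a∈A₁ a′∈A₁ e
    ... | no  a∉A₁ | no  a′∉A₁ = partner-injective M₂ (in-A₂ a∈ a∉A₁) (in-A₂ a′∈ a′∉A₁) e
    ... | yes a∈A₁ | no  a′∉A₁ =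
      contradiction (subst (_∈ B₂) (sym e) (partner-∈ M₂ (in-A₂ a′∈ a′∉A₁))) (disj (partner-∈ M₁ a∈A₁))
    ... | no  a∉A₁ | yes a′∈A₁ =
      contradiction (subst (_∈ B₂) e (partner-∈ M₂ (in-A₂ a∈ a∉A₁))) (disj (partner-∈ M₁ a′∈A₁))

  Critical : Subset n → Subset n → Subset n → Set
  Critical A B S = Nonempty S × S ⊂ A × ∣ B ∩ nbh S ∣ ≤ ∣ S ∣

  critical? : ∀ A B → Decidable (Critical A B)
  critical? A B S = nonempty? S ×-dec (S ⊂? A) ×-dec (∣ B ∩ nbh S ∣ ≤? ∣ S ∣)

  HallBelow : Subset n → Set
  HallBelow A = ∀ {A′} → A′ ⊂ A → ∀ B → HallCondition A′ B → Matching A′ B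

  -- If S is critical, match S into B ∩ N(S) and A ─ S into B ─ N(S); both satisfy
  -- Hall's condition because S uses up all of its neighbours.
  split-at-critical : ∀ {A B S} → HallBelow A → HallCondition A B → Critical A B S → Matching A B
  split-at-critical {A} {B} {S} hall hc ((s , s∈S) , S⊂A , tight) =
    restrict (split-by (p∩q⊆q A S)) parts⊆B (join M₁ M₂ disjoint)
    where
    S⊆A : S ⊆ A
    S⊆A = p⊂q⇒p⊆q S⊂A

    hc₁ : HallCondition S (B ∩ nbh S)
    hc₁ T T⊆S = ≤-trans (hc T (λ x∈T → S⊆A (T⊆S x∈T))) (p⊆q⇒∣p∣≤∣q∣ into)
      where
      into : B ∩ nbh T ⊆ (B ∩ nbh S) ∩ nbh T
      into b∈ = let b∈B , b∈NT = x∈p∩q⁻ B _ b∈ in x∈p∩q⁺ (x∈p∩q⁺ (b∈B , nbh-mono T⊆S b∈NT) , b∈NT)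

    hc₂ : HallCondition (A ─ S) (B ─ nbh S)
    hc₂ T T⊆A─S = +-cancelʳ-≤ ∣ S ∣ _ _ (begin
      ∣ T ∣ + ∣ S ∣                           ≡⟨ disjoint⇒∣p∪q∣≡∣p∣+∣q∣ T S T∩S=∅ ⟨
      ∣ T ∪ S ∣                               ≤⟨ hc (T ∪ S) T∪S⊆A ⟩
      ∣ B ∩ nbh (T ∪ S) ∣                     ≤⟨ ⊆∪⇒∣∣≤∣∣+∣∣ _ _ split ⟩
      ∣ (B ─ nbh S) ∩ nbh T ∣ + ∣ B ∩ nbh S ∣ ≤⟨ +-monoʳ-≤ _ tight ⟩
      ∣ (B ─ nbh S) ∩ nbh T ∣ + ∣ S ∣         ∎)
      where
      open ≤-Reasoning
      T∩S=∅ : Disjoint T S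
      T∩S=∅ x∈T = x∈p─q⇒x∉q A S (T⊆A─S x∈T)
      T∪S⊆A : T ∪ S ⊆ A
      T∪S⊆A x∈ with x∈p∪q⁻ T S x∈
      ... | inj₁ x∈T = p─q⊆p A S (T⊆A─S x∈T)
      ... | inj₂ x∈S = S⊆A x∈S
      split : B ∩ nbh (T ∪ S) ⊆ ((B ─ nbh S) ∩ nbh T) ∪ (B ∩ nbh S)
      split {b} b∈ with x∈p∩q⁻ B _ b∈ | b ∈? nbh S
      ... | b∈B , _    | yes b∈NS = x∈p∪q⁺ (inj₂ (x∈p∩q⁺ (b∈B , b∈NS)))
      ... | b∈B , b∈NTS | no b∉NS with ∈nbh⁻ b∈NTS
      ... | a , a∈T∪S , e with x∈p∪q⁻ T S a∈T∪S
      ...   | inj₁ a∈T = x∈p∪q⁺ (inj₁ (x∈p∩q⁺ (x∈p∧x∉q⇒x∈p─q b∈B b∉NS , ∈nbh⁺ a∈T e)))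
      ...   | inj₂ a∈S = contradiction (∈nbh⁺ a∈S e) b∉NS

    M₁ : Matching S (B ∩ nbh S)
    M₁ = hall S⊂A (B ∩ nbh S) hc₁

    M₂ : Matching (A ─ S) (B ─ nbh S)
    M₂ = hall (p∩q≢∅⇒p─q⊂p A S (s , x∈p∩q⁺ (S⊆A s∈S , s∈S))) (B ─ nbh S) hc₂

    disjoint : Disjoint (B ∩ nbh S) (B ─ nbh S)
    disjoint b∈₁ b∈₂ = x∈p─q⇒x∉q B (nbh S) b∈₂ (proj₂ (x∈p∩q⁻ B _ b∈₁))

    parts⊆B : (B ∩ nbh S) ∪ (B ─ nbh S) ⊆ B
    parts⊆B b∈ with x∈p∪q⁻ (B ∩ nbh S) _ b∈
    ... | inj₁ b∈₁ = p∩q⊆p B _ b∈₁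
    ... | inj₂ b∈₂ = p─q⊆p B _ b∈₂

  -- Without critical sets, match a₀ ∈ A to any neighbour b₀ ∈ B; every nonempty
  -- T ⊆ A - a₀ then has a neighbour to spare, so A - a₀ matches into B - b₀.
  match-one-first : ∀ {A B a₀} → HallBelow A → HallCondition A B → ¬ ∃ (Critical A B) → a₀ ∈ A →
                    Matching A B
  match-one-first {A} {B} {a₀} hall hc no-critical a₀∈A =
    restrict (split-by (p∩q⊆q A ⁅ a₀ ⁆)) parts⊆B (join (single-matching a₀Eb₀) M disjoint)
    where
    b₀-exists : Nonempty (B ∩ nbh ⁅ a₀ ⁆)
    b₀-exists = ∣p∣>0⇒nonempty _ (subst (_≤ ∣ B ∩ nbh ⁅ a₀ ⁆ ∣) (∣⁅x⁆∣≡1 a₀) (hc ⁅ a₀ ⁆ ⁅a₀⁆⊆A))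
      where
      ⁅a₀⁆⊆A : ⁅ a₀ ⁆ ⊆ A
      ⁅a₀⁆⊆A x∈ = subst (_∈ A) (sym (x∈⁅y⁆⇒x≡y a₀ x∈)) a₀∈A

    b₀ : Fin n
    b₀ = proj₁ b₀-exists

    b₀∈B : b₀ ∈ B
    b₀∈B = proj₁ (x∈p∩q⁻ B _ (proj₂ b₀-exists))

    a₀Eb₀ : E a₀ b₀
    a₀Eb₀ with ∈nbh⁻ (proj₂ (x∈p∩q⁻ B _ (proj₂ b₀-exists)))
    ... | a , a∈⁅a₀⁆ , e = subst (λ a → E a b₀) (x∈⁅y⁆⇒x≡y a₀ a∈⁅a₀⁆) e

    hc′ : HallCondition (A - a₀) (B - b₀)
    hc′ T T⊆ with nonempty? T
    ... | no T=∅ = subst (_≤ ∣ (B - b₀) ∩ nbh T ∣) (sym (empty⇒∣p∣≡0 T=∅)) z≤n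
    ... | yes T≠∅ = +-cancelʳ-≤ 1 _ _ (begin
      ∣ T ∣ + 1                         ≡⟨ +-comm _ 1 ⟩
      suc ∣ T ∣                         ≤⟨ ≰⇒> (λ tight → no-critical (T , T≠∅ , T⊂A , tight)) ⟩
      ∣ B ∩ nbh T ∣                     ≤⟨ ⊆∪⇒∣∣≤∣∣+∣∣ _ _ split ⟩
      ∣ (B - b₀) ∩ nbh T ∣ + ∣ ⁅ b₀ ⁆ ∣ ≡⟨ cong (∣ (B - b₀) ∩ nbh T ∣ +_) (∣⁅x⁆∣≡1 b₀) ⟩
      ∣ (B - b₀) ∩ nbh T ∣ + 1          ∎)
      where
      open ≤-Reasoning
      T⊂A : T ⊂ A
      T⊂A = (λ x∈T → p─q⊆p A _ (T⊆ x∈T)) , a₀ , a₀∈A , λ a₀∈T → x∈p─q⇒x∉q A _ (T⊆ a₀∈T) (x∈⁅x⁆ a₀)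
      split : B ∩ nbh T ⊆ ((B - b₀) ∩ nbh T) ∪ ⁅ b₀ ⁆
      split {b} b∈ with x∈p∩q⁻ B _ b∈ | b ∈? ⁅ b₀ ⁆
      ... | _ , _          | yes b∈⁅b₀⁆ = x∈p∪q⁺ (inj₂ b∈⁅b₀⁆)
      ... | b∈B , b∈NT     | no b∉⁅b₀⁆  = x∈p∪q⁺ (inj₁ (x∈p∩q⁺ (x∈p∧x∉q⇒x∈p─q b∈B b∉⁅b₀⁆ , b∈NT)))

    M : Matching (A - a₀) (B - b₀)
    M = hall (x∈p⇒p-x⊂p a₀∈A) (B - b₀) hc′

    disjoint : Disjoint ⁅ b₀ ⁆ (B - b₀)
    disjoint b∈₁ b∈₂ = x∈p─q⇒x∉q B _ b∈₂ b∈₁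

    parts⊆B : ⁅ b₀ ⁆ ∪ (B - b₀) ⊆ B
    parts⊆B b∈ with x∈p∪q⁻ ⁅ b₀ ⁆ _ b∈
    ... | inj₁ b∈₁ = subst (_∈ B) (sym (x∈⁅y⁆⇒x≡y b₀ b∈₁)) b₀∈B
    ... | inj₂ b∈₂ = p─q⊆p B _ b∈₂

  hall : ∀ A B → HallCondition A B → Matching A B
  hall A = go A (⊂-wellFounded A)
    where
    go : ∀ A → Acc _⊂_ A → ∀ B → HallCondition A B → Matching A B
    go A (acc smaller) B hc with nonempty? A | anySubset? (critical? A B)
    ... | no A=∅          | _               = empty-matching A=∅
    ... | yes _           | yes (S , crit)  = split-at-critical (λ A′⊂A → go _ (smaller A′⊂A)) hc crit
    ... | yes (a₀ , a₀∈A) | no no-critical  =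
      match-one-first (λ A′⊂A → go _ (smaller A′⊂A)) hc no-critical a₀∈A

-- An injective self-map σ of Fin n that fixes each point or moves it strictly up in a
-- strict order ≺ is the identity: the orbit of a moved point would climb for ever,
-- yet by pigeonhole it returns to its start.
upward-injection-is-identity :
  ∀ {n ℓ} (_≺_ : Fin n → Fin n → Set ℓ) → (∀ {i} → ¬ i ≺ i) → (∀ {i j k} → i ≺ j → j ≺ k → i ≺ k) →
  (σ : Fin n → Fin n) → (∀ {i j} → σ i ≡ σ j → i ≡ j) → (∀ i → σ i ≡ i ⊎ i ≺ σ i) → ∀ i → σ i ≡ i
upward-injection-is-identity {n} _≺_ irrefl ≺-trans σ σ-inj up i₀ with σ i₀ Fin.≟ i₀
... | yes fixed = fixed
... | no moved  = let d , back = returns in contradiction (subst (i₀ ≺_) back (climbs d)) irrefl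
  where
  orbit : ℕ → Fin n
  orbit k = fold i₀ σ k

  climbs : ∀ k → i₀ ≺ orbit (suc k)
  climbs zero with up i₀
  ... | inj₁ fixed = contradiction fixed moved
  ... | inj₂ i₀≺σi₀ = i₀≺σi₀
  climbs (suc k) with up (orbit (suc k))
  ... | inj₁ fixed = subst (i₀ ≺_) (sym fixed) (climbs k)
  ... | inj₂ step  = ≺-trans (climbs k) step

  power-injective : ∀ k {i j} → fold i σ k ≡ fold j σ k → i ≡ j
  power-injective zero    e = e
  power-injective (suc k) e = power-injective k (σ-inj e)

  -- by pigeonhole two of orbit 0, …, orbit n coincide, so some orbit (suc d) is i₀ again
  returns : ∃ λ d → orbit (suc d) ≡ i₀
  returns with pigeonhole (n<1+n n) (λ t → orbit (toℕ t))
  ... | p , q , p<q , same with m≤n⇒∃[o]m+o≡n p<q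
  ... | d , p+1+d≡q = d , sym (power-injective (toℕ p) (begin
    orbit (toℕ p)                   ≡⟨ same ⟩
    orbit (toℕ q)                   ≡⟨ cong orbit (trans (sym p+1+d≡q) (sym (+-suc (toℕ p) d))) ⟩
    orbit (toℕ p + suc d)           ≡⟨ fold-+ i₀ σ (toℕ p) ⟩
    fold (orbit (suc d)) σ (toℕ p)  ∎))
    where open ≡-Reasoning

≢-≢⇒≡ : ∀ {p q r : Bool} → p ≢ q → q ≢ r → p ≡ r
≢-≢⇒≡ p≢q q≢r = trans (¬-not p≢q) (trans (cong not (¬-not q≢r)) (not-involutive _))

module _ (G : Graph) where
  open Graph G using (vtx; adj) renaming (sym to adj-sym; irrefl to adj-irrefl)

  edge? : ∀ u v → Dec (Edge G u v)
  edge? u v = adj u v Bool.≟ true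

  edge-sym : ∀ {u v} → Edge G u v → Edge G v u
  edge-sym {u} {v} e = trans (adj-sym v u) e

  non-edge : ∀ {u v} → ¬ Edge G u v → adj u v ≡ false
  non-edge = ¬-not

  ¬edge : ∀ {u v} → adj u v ≡ false → ¬ Edge G u v
  ¬edge no-edge e with trans (sym e) no-edge
  ... | ()

  independent? : Decidable (Independent G)
  independent? I = all? λ u → all? λ v → (u ∈? I) →-dec (v ∈? I) →-dec (adj u v Bool.≟ false)

  extend-independent : ∀ {I} → Independent G I → ∃ λ M → I ⊆ M × MaximalIndependent G M
  extend-independent = extend-to-maximal independent?

  non-adjacent-pair : ∀ {u v} → adj u v ≡ false → Independent G (⁅ u ⁆ ∪ ⁅ v ⁆)
  non-adjacent-pair {u} {v} no-edge w w′ w∈ w′∈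
    with x∈p∪q⁻ ⁅ u ⁆ ⁅ v ⁆ w∈ | x∈p∪q⁻ ⁅ u ⁆ ⁅ v ⁆ w′∈
  ... | inj₁ w∈u | inj₁ w′∈u
    rewrite x∈⁅y⁆⇒x≡y u w∈u | x∈⁅y⁆⇒x≡y u w′∈u = adj-irrefl u
  ... | inj₂ w∈v | inj₂ w′∈v
    rewrite x∈⁅y⁆⇒x≡y v w∈v | x∈⁅y⁆⇒x≡y v w′∈v = adj-irrefl v
  ... | inj₁ w∈u | inj₂ w′∈v
    rewrite x∈⁅y⁆⇒x≡y u w∈u | x∈⁅y⁆⇒x≡y v w′∈v = no-edge
  ... | inj₂ w∈v | inj₁ w′∈u
    rewrite x∈⁅y⁆⇒x≡y v w∈v | x∈⁅y⁆⇒x≡y u w′∈u = trans (adj-sym v u) no-edge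

  record PerfectMatching : Set where
    field
      mate            : Fin vtx → Fin vtx
      mate-involutive : ∀ v → mate (mate v) ≡ v
      mate-edge       : ∀ v → Edge G v (mate v)

  -- A matched partition: a pure order without condition (ii), i.e. a partition of the
  -- vertices into independent lists x and y with every x i – y i an edge.
  record MatchedPartition : Set where
    field
      n      : ℕ
      x      : Fin n → Fin vtx
      y      : Fin n → Fin vtx
      x-inj  : ∀ {i j} → x i ≡ x j → i ≡ j
      y-inj  : ∀ {i j} → y i ≡ y j → i ≡ j
      disj   : ∀ i j → x i ≢ y j
      cover  : ∀ v → (∃ λ i → x i ≡ v) ⊎ (∃ λ i → y i ≡ v)
      x-ind  : ∀ i j → adj (x i) (x j) ≡ false
      y-ind  : ∀ i j → adj (y i) (y j) ≡ false
      cond-i : ∀ i → Edge G (x i) (y i)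

    CondII : Set
    CondII = ∀ i j k → i ≢ j → j ≢ k → i ≢ k →
             Edge G (x i) (y j) → Edge G (x j) (y k) → Edge G (x i) (y k)

  matchedPartition : PureOrder G → MatchedPartition
  matchedPartition P = record
    { n = n ; x = x ; y = y ; x-inj = x-inj ; y-inj = y-inj ; disj = disj ; cover = cover
    ; x-ind = x-ind ; y-ind = y-ind ; cond-i = cond-i }
    where open PureOrder P

  pureOrder : (P : MatchedPartition) → MatchedPartition.CondII P → PureOrder G
  pureOrder P cond-ii = record
    { n = n ; x = x ; y = y ; x-inj = x-inj ; y-inj = y-inj ; disj = disj ; cover = cover
    ; x-ind = x-ind ; y-ind = y-ind ; cond-i = cond-i ; cond-ii = cond-ii }
    where open MatchedPartition P

  module MatchedPartitionTheory (P : MatchedPartition) where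
    open MatchedPartition P

    pair : Fin vtx → Fin n
    pair v with cover v
    ... | inj₁ (i , _) = i
    ... | inj₂ (i , _) = i

    -- pairs are edges, so an independent set meets each pair at most once
    pair-injective : ∀ {I} → Independent G I → InjectiveOn I pair
    pair-injective {I} I-ind {u} {w} u∈I w∈I same with cover u | cover w
    ... | inj₁ (i , refl) | inj₁ (j , refl) = cong x same
    ... | inj₂ (i , refl) | inj₂ (j , refl) = cong y same
    ... | inj₁ (i , refl) | inj₂ (j , refl) =
      contradiction (subst (λ k → Edge G (x i) (y k)) same (cond-i i)) (¬edge (I-ind _ _ u∈I w∈I))
    ... | inj₂ (i , refl) | inj₁ (j , refl) =
      contradiction (subst (λ k → Edge G (x k) (y i)) same (cond-i i)) (¬edge (I-ind _ _ w∈I u∈I))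

    independent-missing-pair : ∀ {I j} → Independent G I → x j ∉ I → y j ∉ I → ∣ I ∣ < n
    independent-missing-pair {I} {j} I-ind xj∉I yj∉I = begin-strict
      ∣ I ∣     ≤⟨ injection⇒≤ I into (pair-injective I-ind) ⟩
      ∣ ⊤ - j ∣ <⟨ x∈p⇒∣p-x∣<∣p∣ (∈⊤ {x = j}) ⟩
      ∣ ⊤ {n} ∣ ≡⟨ ∣⊤∣≡n n ⟩
      n         ∎
      where
      open ≤-Reasoning
      into : MapsInto I (⊤ - j) pair
      into {v} v∈I with cover v
      ... | inj₁ (i , refl) = x∈p∧x≢y⇒x∈p-y ∈⊤ (λ i≡j → xj∉I (subst (λ k → x k ∈ I) i≡j v∈I))
      ... | inj₂ (i , refl) = x∈p∧x≢y⇒x∈p-y ∈⊤ (λ i≡j → yj∉I (subst (λ k → y k ∈ I) i≡j v∈I))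

    is-left? : Decidable (λ v → ∃ λ i → x i ≡ v)
    is-left? v = any? (λ i → x i Fin.≟ v)

    left : Subset vtx
    left = ⟦ is-left? ⟧

    -- it is a maximal independent set: any other vertex y k is adjacent to x k
    left-maximal : MaximalIndependent G left
    left-maximal = left-ind , maximal
      where
      left-ind : Independent G left
      left-ind u v u∈ v∈ with ∈⟦⟧⁻ is-left? u∈ | ∈⟦⟧⁻ is-left? v∈
      ... | i , refl | j , refl = x-ind i j
      maximal : ∀ T → Independent G T → left ⊆ T → T ⊆ left
      maximal T T-ind left⊆T {v} v∈T with cover v
      ... | inj₁ (i , refl) = ∈⟦⟧⁺ is-left? (i , refl)
      ... | inj₂ (k , refl) =
        contradiction (cond-i k) (¬edge (T-ind _ _ (left⊆T (∈⟦⟧⁺ is-left? (k , refl))) v∈T))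

    left-size : n ≤ ∣ left ∣
    left-size = ≤-trans (≤-reflexive (sym (∣⊤∣≡n n)))
                        (injection⇒≤ ⊤ (λ {i} _ → ∈⟦⟧⁺ is-left? (i , refl)) (λ _ _ → x-inj))

    -- If x i – y k were no edge,
    -- extend {x i , y k} to a maximal independent set M; M misses x j (adjacent to y k)
    -- and y j (adjacent to x i), so ∣ M ∣ < n ≤ ∣ left ∣, against purity.
    pure⇒cond-ii : PureInd G → CondII
    pure⇒cond-ii pure i j k _ _ _ xi–yj xj–yk with edge? (x i) (y k)
    ... | yes xi–yk = xi–yk
    ... | no  xi≁yk with extend-independent (non-adjacent-pair (non-edge xi≁yk))
    ... | M , I⊆M , M-ind , M-max =
      contradiction (≤-trans left-size (≤-reflexive (pure left M left-maximal (M-ind , M-max))))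
                    (<⇒≱ (independent-missing-pair M-ind xj∉M yj∉M))
      where
      xi∈M : x i ∈ M
      xi∈M = I⊆M (x∈p∪q⁺ (inj₁ (x∈⁅x⁆ (x i))))
      yk∈M : y k ∈ M
      yk∈M = I⊆M (x∈p∪q⁺ (inj₂ (x∈⁅x⁆ (y k))))
      xj∉M : x j ∉ M
      xj∉M xj∈M = ¬edge (M-ind _ _ xj∈M yk∈M) xj–yk
      yj∉M : y j ∉ M
      yj∉M yj∈M = ¬edge (M-ind _ _ xi∈M yj∈M) xi–yj

    module Rematch (π : Permutation n n) (π-edge : ∀ i → Edge G (x i) (y (π ⟨$⟩ʳ i))) where

      mate : Fin vtx → Fin vtx
      mate v with cover v
      ... | inj₁ (i , _) = y (π ⟨$⟩ʳ i)
      ... | inj₂ (j , _) = x (π ⟨$⟩ˡ j)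

      mate-x : ∀ i → mate (x i) ≡ y (π ⟨$⟩ʳ i)
      mate-x i with cover (x i)
      ... | inj₁ (i′ , xi′≡xi) = cong (λ k → y (π ⟨$⟩ʳ k)) (x-inj xi′≡xi)
      ... | inj₂ (j , yj≡xi)   = contradiction (sym yj≡xi) (disj i j)

      mate-y : ∀ j → mate (y j) ≡ x (π ⟨$⟩ˡ j)
      mate-y j with cover (y j)
      ... | inj₁ (i , xi≡yj)   = contradiction xi≡yj (disj i j)
      ... | inj₂ (j′ , yj′≡yj) = cong (λ k → x (π ⟨$⟩ˡ k)) (y-inj yj′≡yj)

      perfectMatching : PerfectMatching
      perfectMatching = record { mate = mate ; mate-involutive = involutive ; mate-edge = edge }
        where
        involutive : ∀ v → mate (mate v) ≡ v
        involutive v with cover v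
        ... | inj₁ (i , refl) = trans (mate-y (π ⟨$⟩ʳ i)) (cong x (inverseˡ π))
        ... | inj₂ (j , refl) = trans (mate-x (π ⟨$⟩ˡ j)) (cong y (inverseʳ π))
        edge : ∀ v → Edge G v (mate v)
        edge v with cover v
        ... | inj₁ (i , refl) = π-edge i
        ... | inj₂ (j , refl) =
          edge-sym (subst (λ k → Edge G (x (π ⟨$⟩ˡ j)) (y k)) (inverseʳ π) (π-edge (π ⟨$⟩ˡ j)))

  module CrossFree (Q : PureOrder G) (cross-free : ¬ HasCross G Q) where
    open PureOrder Q
    open PerfectMatching

    mate-of-x : (M : PerfectMatching) → ∀ i → ∃ λ j → y j ≡ mate M (x i)
    mate-of-x M i with cover (mate M (x i))
    ... | inj₁ (j , xj≡mate) =
      contradiction (subst (Edge G (x i)) (sym xj≡mate) (mate-edge M (x i))) (¬edge (x-ind i j))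
    ... | inj₂ (j , yj≡mate) = j , yj≡mate

    -- i ≺ j: x i is joined to y j for some other j; transitive by condition (ii),
    -- where cross-freeness rules out i ≡ k
    _≺_ : Fin n → Fin n → Set
    i ≺ j = i ≢ j × Edge G (x i) (y j)

    ≺-trans : ∀ {i j k} → i ≺ j → j ≺ k → i ≺ k
    ≺-trans {i} {j} {k} (i≢j , xi–yj) (j≢k , xj–yk) = i≢k , cond-ii i j k i≢j j≢k i≢k xi–yj xj–yk
      where
      i≢k : i ≢ k
      i≢k refl = cross-free (i , j , i≢j , xi–yj , xj–yk)

    -- every perfect matching pairs x i with y i: the induced map σ on indices, with
    -- y (σ i) the mate of x i, is injective and only moves upward in ≺, so σ i ≡ i
    mate-x : ∀ M i → mate M (x i) ≡ y i
    mate-x M i = trans (sym (σ-spec i)) (cong y σ-fixes-i)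
      where
      σ : Fin n → Fin n
      σ j = proj₁ (mate-of-x M j)
      σ-spec : ∀ j → y (σ j) ≡ mate M (x j)
      σ-spec j = proj₂ (mate-of-x M j)
      σ-inj : ∀ {j k} → σ j ≡ σ k → j ≡ k
      σ-inj {j} {k} e = x-inj (begin
        x j                    ≡⟨ mate-involutive M (x j) ⟨
        mate M (mate M (x j))  ≡⟨ cong (mate M) (trans (sym (σ-spec j)) (trans (cong y e) (σ-spec k))) ⟩
        mate M (mate M (x k))  ≡⟨ mate-involutive M (x k) ⟩
        x k                    ∎)
        where open ≡-Reasoning
      up : ∀ j → σ j ≡ j ⊎ j ≺ σ j
      up j with σ j Fin.≟ j
      ... | yes fixed = inj₁ fixed
      ... | no  moved =
        inj₂ ((λ e → moved (sym e)) , subst (Edge G (x j)) (sym (σ-spec j)) (mate-edge M (x j)))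
      σ-fixes-i : σ i ≡ i
      σ-fixes-i = upward-injection-is-identity _≺_ (λ i≺i → proj₁ i≺i refl) ≺-trans σ σ-inj up i

    unique : ∀ M M′ v → mate M v ≡ mate M′ v
    unique M M′ v with cover v
    ... | inj₁ (i , refl) = trans (mate-x M i) (sym (mate-x M′ i))
    ... | inj₂ (i , refl) = trans (mate-y M) (sym (mate-y M′))
      where
      mate-y : ∀ M → mate M (y i) ≡ x i
      mate-y M = trans (cong (mate M) (sym (mate-x M i))) (mate-involutive M (x i))

  -- having a cross is decidable (used to conclude HasCross from its impossible negation)
  hasCross? : (P : PureOrder G) → Dec (HasCross G P)
  hasCross? P = any? λ i → any? λ j → (¬? (i Fin.≟ j)) ×-dec edge? (x i) (y j) ×-dec edge? (x j) (y i)
    where open PureOrder P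

  -- If one pure order has a cross, so does every other: a cross in P yields two distinct
  -- perfect matchings (straight and crossed), whereas a cross-free Q allows only one.
  cross-spreads : (P : PureOrder G) → HasCross G P → (Q : PureOrder G) → HasCross G Q
  cross-spreads P (a , b , a≢b , xa–yb , xb–ya) Q with hasCross? Q
  ... | yes Q-cross = Q-cross
  ... | no  cross-free = contradiction (y-inj ya≡yb) a≢b
    where
    open PureOrder P
    open MatchedPartitionTheory (matchedPartition P)
    open CrossFree Q cross-free using (unique)

    crossed-edge : ∀ i → Edge G (x i) (y (transpose a b ⟨$⟩ʳ i))
    crossed-edge i with i Fin.≟ a
    ... | yes refl = xa–yb
    ... | no  _ with i Fin.≟ b
    ...   | yes refl = xb–ya
    ...   | no  _    = cond-i i

    straight crossed : PerfectMatching
    straight = Rematch.perfectMatching id cond-i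
    crossed  = Rematch.perfectMatching (transpose a b) crossed-edge

    ya≡yb : y a ≡ y b
    ya≡yb = begin
      y a                                ≡⟨ Rematch.mate-x id cond-i a ⟨
      PerfectMatching.mate straight (x a) ≡⟨ unique straight crossed (x a) ⟩
      PerfectMatching.mate crossed (x a)  ≡⟨ Rematch.mate-x (transpose a b) crossed-edge a ⟩
      y (transpose a b ⟨$⟩ʳ a)           ≡⟨ cong y (transpose-a) ⟩
      y b                                ∎
      where
      open ≡-Reasoning
      transpose-a : transpose a b ⟨$⟩ʳ a ≡ b
      transpose-a with a Fin.≟ a
      ... | yes _  = refl
      ... | no a≢a = contradiction refl a≢a

  -- Existence of a pure order (Villarreal): the two colour classes are maximal independent
  -- sets, purity gives Hall's condition between them, and the resulting perfect matching,
  -- read as a matched partition, satisfies condition (ii) by purity again.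
  module Existence (bipartite : Bipartite G) (no-isolated : NoIsolated G) (pure : PureInd G) where

    colour : Fin vtx → Bool
    colour = proj₁ bipartite

    class? : ∀ b → Decidable (λ v → colour v ≡ b)
    class? b v = colour v Bool.≟ b

    class : Bool → Subset vtx
    class b = ⟦ class? b ⟧

    class-independent : ∀ b → Independent G (class b)
    class-independent b u v u∈ v∈ =
      non-edge (λ e → proj₂ bipartite u v e (trans (∈⟦⟧⁻ (class? b) u∈) (sym (∈⟦⟧⁻ (class? b) v∈))))

    -- a vertex outside class b has a neighbour, which lies in class b
    class-maximal : ∀ b → MaximalIndependent G (class b)
    class-maximal b = class-independent b , maximal
      where
      maximal : ∀ T → Independent G T → class b ⊆ T → T ⊆ class b
      maximal T T-ind class⊆T {v} v∈T with colour v Bool.≟ b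
      ... | yes cv≡b = ∈⟦⟧⁺ (class? b) cv≡b
      ... | no  cv≢b =
        let w , v–w = no-isolated v
            cw≡b    = ≢-≢⇒≡ (λ e → proj₂ bipartite v w v–w (sym e)) cv≢b
        in contradiction v–w (¬edge (T-ind _ _ v∈T (class⊆T (∈⟦⟧⁺ (class? b) cw≡b))))

    A B : Subset vtx
    A = class true
    B = class false

    A∩B=∅ : Disjoint A B
    A∩B=∅ v∈A v∈B with trans (sym (∈⟦⟧⁻ (class? true) v∈A)) (∈⟦⟧⁻ (class? false) v∈B)
    ... | ()

    open Hall edge?

    -- For S ⊆ A the set S ∪ (B ─ N(S)) is independent, hence of size at most ∣ B ∣ by purity.
    hall-condition : HallCondition A B
    hall-condition S S⊆A = size-bound (extend-independent I-ind)
      where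
      I : Subset vtx
      I = S ∪ (B ─ nbh S)

      I-ind : Independent G I
      I-ind u v u∈ v∈ with x∈p∪q⁻ S _ u∈ | x∈p∪q⁻ S _ v∈
      ... | inj₁ u∈S | inj₁ v∈S = class-independent true u v (S⊆A u∈S) (S⊆A v∈S)
      ... | inj₂ u∈R | inj₂ v∈R = class-independent false u v (p─q⊆p B _ u∈R) (p─q⊆p B _ v∈R)
      ... | inj₁ u∈S | inj₂ v∈R = non-edge (λ e → x∈p─q⇒x∉q B _ v∈R (∈nbh⁺ u∈S e))
      ... | inj₂ u∈R | inj₁ v∈S = non-edge (λ e → x∈p─q⇒x∉q B _ u∈R (∈nbh⁺ v∈S (edge-sym e)))

      S∩R=∅ : Disjoint S (B ─ nbh S)
      S∩R=∅ v∈S v∈R = A∩B=∅ (S⊆A v∈S) (p─q⊆p B _ v∈R)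

      size-bound : (∃ λ M → I ⊆ M × MaximalIndependent G M) → ∣ S ∣ ≤ ∣ B ∩ nbh S ∣
      size-bound (M , I⊆M , M-max) = +-cancelʳ-≤ ∣ B ─ nbh S ∣ _ _ (begin
        ∣ S ∣ + ∣ B ─ nbh S ∣              ≡⟨ disjoint⇒∣p∪q∣≡∣p∣+∣q∣ S _ S∩R=∅ ⟨
        ∣ I ∣                              ≤⟨ p⊆q⇒∣p∣≤∣q∣ I⊆M ⟩
        ∣ M ∣                              ≡⟨ pure M B M-max (class-maximal false) ⟩
        ∣ B ∣                              ≤⟨ ⊆∪⇒∣∣≤∣∣+∣∣ (B ∩ nbh S) (B ─ nbh S) (split-by (λ v∈ → v∈)) ⟩
        ∣ B ∩ nbh S ∣ + ∣ B ─ nbh S ∣      ∎)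
        where open ≤-Reasoning

    -- Hall's theorem matches A into B; as ∣ A ∣ = ∣ B ∣ by purity, the matching is onto B.
    module FromMatching (M : Matching A B) where
      open Matching M

      x y : Fin ∣ A ∣ → Fin vtx
      x = enum A
      y i = partner (enum A i)

      partner-onto : ∀ {v} → v ∈ B → ∃ λ a → a ∈ A × partner a ≡ v
      partner-onto = injection⇒onto A (≤-reflexive (pure B A (class-maximal false) (class-maximal true)))
                                    partner-∈ partner-injective

      cover : ∀ v → (∃ λ i → x i ≡ v) ⊎ (∃ λ i → y i ≡ v)
      cover v with colour v Bool.≟ true
      ... | yes cv≡true = inj₁ (enum-onto A (∈⟦⟧⁺ (class? true) cv≡true))
      ... | no  cv≢true with partner-onto (∈⟦⟧⁺ (class? false) (¬-not cv≢true))
      ... | a , a∈A , partner-a≡v with enum-onto A a∈A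
      ... | i , xi≡a = inj₂ (i , trans (cong partner xi≡a) partner-a≡v)

      matched : MatchedPartition
      matched = record
        { n = ∣ A ∣ ; x = x ; y = y
        ; x-inj = enum-injective A
        ; y-inj = λ e → enum-injective A (partner-injective (enum-∈ A _) (enum-∈ A _) e)
        ; disj = λ i j xi≡yj → A∩B=∅ (enum-∈ A i) (subst (_∈ B) (sym xi≡yj) (partner-∈ (enum-∈ A j)))
        ; cover = cover
        ; x-ind = λ i j → class-independent true _ _ (enum-∈ A i) (enum-∈ A j)
        ; y-ind = λ i j → class-independent false _ _ (partner-∈ (enum-∈ A i)) (partner-∈ (enum-∈ A j))
        ; cond-i = λ i → partner-edge (enum-∈ A i) }

    pure-order : PureOrder G
    pure-order = pureOrder P (MatchedPartitionTheory.pure⇒cond-ii P pure)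
      where
      P : MatchedPartition
      P = FromMatching.matched (hall A B hall-condition)

lemma4p5 : (G : Graph) → Bipartite G → NoIsolated G → PureInd G →
           ((∀ (P : PureOrder G) → HasCross G P) ⇔ (∃ λ (P : PureOrder G) → HasCross G P))
lemma4p5 G bipartite no-isolated pure = mk⇔
  (λ every-has-cross → P₀ , every-has-cross P₀)
  (λ (P , P-cross) Q → cross-spreads G P P-cross Q)
  where
  P₀ : PureOrder G
  P₀ = Existence.pure-order G bipartite no-isolated pure
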